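{- Let $M\models T$ (described below), in the language $L_C$, and let $M^\star$ be the associated $L^\star$-structure on $M/E$. For every equivalence formula $\phi(x_0,\ldots,x_{n-1})$ there is an $L^\star$-formula $\phi^\star(x_0,\ldots,x_{n-1})$ such that for all $a_0,\ldots,a_{n-1}\in M$, $M\models\phi(a_0,\ldots,a_{n-1})$ if and only if $M^\star\models\phi^\star([a_0]_E,\ldots,[a_{n-1}]_E)$.
   Context: $E$ is a binary relation and $f,g$ unary functions; for $s = s_1\cdots s_n\in\{f,g\}^n$, $s(x)$ denotes $s_1(s_2(\cdots s_n(x)\cdots))$. $T_0$: (a) $E$ is an equivalence relation; (b) $xEy \to f(x)Eg(y)$; (c) there is a single class $C_{fin} = \{x: f(x)=x\}=\{x:g(x)=x\}$; (d) there is a single class $C_{init} = \{x:\text{no } z \text{ has } f(z)=x\} = \{x:\text{no } z\text{ has } g(z)=x\}$; (e) $x,y\notin C_{fin}$ and $f(x)Ef(y)$ imply $xEy$; (f) for each class $C\ne C_{init}$ and $(x,y)\in C^2$ there is a unique $z$ (unique $z\notin C_{fin}$ if $C=C_{fin}$) with $f(z)=x$, $g(z)=y$. $T = T_0$ plus (g) for $k\ge1$, $x\notin C_{fin}\to\neg(f^k(x)Ex)$; (h) infinitely many classes; (i) all classes infinite. $L_C$ expands $\{E,f,g\}$ by unary predicates $C_{init+k}$ ($=f^k(C_{init})$) and $C_{fin-k}$ ($C_{fin-0}=C_{fin}$, $C_{fin-k} = f^{ -k}(C_{fin})\setminus f^{ -(k-1)}(C_{fin})$ for $k\ge1$). An equivalence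 formula is an $L_C$-formula not using the equality symbol. $L^\star$ has a unary function $S$ and constants $c_{init},c_{fin}$; $M^\star$ has universe $M/E$, $c_{init}=C_{init}$, $c_{fin}=C_{fin}$, and $S([a]_E) = [f(a)]_E$. -}

module Defs where

open import Level using (0ℓ)
open import Data.Nat using (ℕ; zero; suc)
open import Data.Fin using (Fin; zero; suc)
open import Data.Product using (Σ; ∃; _×_; _,_)
open import Data.Sum using (_⊎_)
open import Data.Empty using (⊥)
open import Data.Unit using (⊤)
open import Relation.Nullary using (¬_)
open import Relation.Binary.PropositionalEquality using (_≡_)
open import Relation.Binary.Structures using (IsEquivalence)
open import Function using (_∘_)
open import Function.Bundles using (_⇔_)

iter : {A : Set} → (A → A) → ℕ → A → A
iter h zero    x = x
iter h (suc k) x = h (iter h k x)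

record Str : Set₁ where
  field
    M : Set
    E : M → M → Set
    f : M → M
    g : M → M

module _ (S : Str) where
  open Str S

  FixF : M → Set
  FixF x = f x ≡ x

  FixG : M → Set
  FixG x = g x ≡ x

  NoPreF : M → Set
  NoPreF x = ¬ (Σ M λ z → f z ≡ x)

  NoPreG : M → Set
  NoPreG x = ¬ (Σ M λ z → g z ≡ x)

  IsClass : (M → Set) → Set
  IsClass P = Σ M λ c → (x : M) → P x ⇔ E x c

  ∃!≡ : (M → Set) → Set
  ∃!≡ P = Σ M λ z → P z × ((z' : M) → P z' → z' ≡ z)

  record IsModelT : Set where
    field
      equiv    : IsEquivalence E
      compat   : ∀ {x y} → E x y → E (f x) (g y)
      fin-fg   : ∀ x → FixF x ⇔ FixG x
      fin-cls  : IsClass FixF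
      init-fg  : ∀ x → NoPreF x ⇔ NoPreG x
      init-cls : IsClass NoPreF
      ax-e     : ∀ {x y} → ¬ FixF x → ¬ FixF y → E (f x) (f y) → E x y
      -- (f) for a class C ≠ C_init (i.e. x ∉ C_init) and x,y ∈ C
      ax-f-fin : ∀ x y → E x y → ¬ NoPreF x → FixF x →
                 ∃!≡ (λ z → ¬ FixF z × f z ≡ x × g z ≡ y)
      ax-f     : ∀ x y → E x y → ¬ NoPreF x → ¬ FixF x →
                 ∃!≡ (λ z → f z ≡ x × g z ≡ y)
      ax-g     : ∀ (k : ℕ) x → ¬ FixF x → ¬ E (iter f (suc k) x) x
      -- (h) infinitely many classes: for every n, n pairwise inequivalent elements
      ax-h     : ∀ (n : ℕ) → Σ (Fin n → M) λ v →
                   ∀ i j → ¬ (i ≡ j) → ¬ E (v i) (v j)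
      -- (i) every class is infinite: every class has n distinct elements
      ax-i     : ∀ (x : M) (n : ℕ) → Σ (Fin n → M) λ v →
                   (∀ i → E x (v i)) × (∀ i j → ¬ (i ≡ j) → ¬ (v i ≡ v j))

  CInit+ : ℕ → M → Set
  CInit+ k x = Σ M λ z → NoPreF z × iter f k z ≡ x

  CFin- : ℕ → M → Set
  CFin- zero    x = FixF x
  CFin- (suc k) x = FixF (iter f (suc k) x) × ¬ FixF (iter f k x)

-- Syntax of L_C without equality (equivalence formulas), de Bruijn style:
-- a formula in `EqFormula n` has free variables among x₀,…,x_{n-1}.

data CTerm (n : ℕ) : Set where
  var : Fin n → CTerm n
  `f  : CTerm n → CTerm n
  `g  : CTerm n → CTerm n

data EqFormula : ℕ → Set where
  `E      : ∀ {n} → CTerm n → CTerm n → EqFormula n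
  `CInit+ : ∀ {n} → ℕ → CTerm n → EqFormula n
  `CFin-  : ∀ {n} → ℕ → CTerm n → EqFormula n
  `⊤ `⊥   : ∀ {n} → EqFormula n
  `¬      : ∀ {n} → EqFormula n → EqFormula n
  _`∧_ _`∨_ _`⇒_ : ∀ {n} → EqFormula n → EqFormula n → EqFormula n
  `∀ `∃   : ∀ {n} → EqFormula (suc n) → EqFormula n

extend : {A : Set} {n : ℕ} → A → (Fin n → A) → Fin (suc n) → A
extend a ρ zero    = a
extend a ρ (suc i) = ρ i

module _ (S : Str) where
  open Str S

  evalC : ∀ {n} → (Fin n → M) → CTerm n → M
  evalC ρ (var i) = ρ i
  evalC ρ (`f t)  = f (evalC ρ t)
  evalC ρ (`g t)  = g (evalC ρ t)

  satC : ∀ {n} → EqFormula n → (Fin n → M) → Set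
  satC (`E t s)      ρ = E (evalC ρ t) (evalC ρ s)
  satC (`CInit+ k t) ρ = CInit+ S k (evalC ρ t)
  satC (`CFin- k t)  ρ = CFin- S k (evalC ρ t)
  satC `⊤            ρ = ⊤
  satC `⊥            ρ = ⊥
  satC (`¬ φ)        ρ = ¬ satC φ ρ
  satC (φ `∧ ψ)      ρ = satC φ ρ × satC ψ ρ
  satC (φ `∨ ψ)      ρ = satC φ ρ ⊎ satC ψ ρ
  satC (φ `⇒ ψ)      ρ = satC φ ρ → satC ψ ρ
  satC (`∀ φ)        ρ = (a : M) → satC φ (extend a ρ)
  satC (`∃ φ)        ρ = Σ M λ a → satC φ (extend a ρ)

data STerm (n : ℕ) : Set where
  var    : Fin n → STerm n
  `S     : STerm n → STerm n
  `cinit : STerm n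
  `cfin  : STerm n

data SFormula : ℕ → Set where
  _`≐_   : ∀ {n} → STerm n → STerm n → SFormula n
  `⊤ `⊥  : ∀ {n} → SFormula n
  `¬     : ∀ {n} → SFormula n → SFormula n
  _`∧_ _`∨_ _`⇒_ : ∀ {n} → SFormula n → SFormula n → SFormula n
  `∀ `∃  : ∀ {n} → SFormula (suc n) → SFormula n

record StarStr : Set₁ where
  field
    Q     : Set
    S     : Q → Q
    cinit : Q
    cfin  : Q

module _ (N : StarStr) where
  open StarStr N

  evalS : ∀ {n} → (Fin n → Q) → STerm n → Q
  evalS ρ (var i) = ρ i
  evalS ρ (`S t)  = S (evalS ρ t)
  evalS ρ `cinit  = cinit
  evalS ρ `cfin   = cfin

  satS : ∀ {n} → SFormula n → (Fin n → Q) → Set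
  satS (t `≐ s) ρ = evalS ρ t ≡ evalS ρ s
  satS `⊤       ρ = ⊤
  satS `⊥       ρ = ⊥
  satS (`¬ φ)   ρ = ¬ satS φ ρ
  satS (φ `∧ ψ) ρ = satS φ ρ × satS ψ ρ
  satS (φ `∨ ψ) ρ = satS φ ρ ⊎ satS ψ ρ
  satS (φ `⇒ ψ) ρ = satS φ ρ → satS ψ ρ
  satS (`∀ φ)   ρ = (q : Q) → satS φ (extend q ρ)
  satS (`∃ φ)   ρ = Σ Q λ q → satS φ (extend q ρ)

-- Since Agda has no quotient types, M/E is
-- presented by any set Q with a surjection π : M → Q whose kernel is E
-- (this determines Q up to unique bijection), with
--   S [a] = [f a],  c_init = C_init,  c_fin = C_fin.

record IsStarOf (Sₘ : Str) (N : StarStr) (π : Str.M Sₘ → StarStr.Q N) : Set where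
  open Str Sₘ
  open StarStr N
  field
    surj     : ∀ q → Σ M λ a → π a ≡ q
    kernel   : ∀ a b → (π a ≡ π b) ⇔ E a b
    S-π      : ∀ a → S (π a) ≡ π (f a)
    cinit-π  : ∀ a → NoPreF Sₘ a → cinit ≡ π a
    cfin-π   : ∀ a → FixF Sₘ a → cfin ≡ π a

-- E is the kernel of π : M → M/E, and C_fin, C_init are E-classes, so every
-- atomic equivalence formula about E, C_fin or C_init is an equation in M/E.
-- By (b) with x = y, f and g induce the same map S on M/E. The class C_{init+k}
-- is the point S^k(c_init): the nontrivial inclusion uses (f) and (e) to show
-- that every element of the class S[w] is the f-image of an element of [w].
-- Quantifiers over M become quantifiers over M/E because π is surjective.
module Submission where

open import Defs
open import Level using (0ℓ)
open import Data.Nat using (ℕ; zero; suc)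
open import Data.Fin using (Fin; zero; suc)
open import Data.Product using (Σ; ∃; _×_; _,_)
open import Data.Product.Function.NonDependent.Propositional using (_×-⇔_)
open import Data.Sum.Function.Propositional using (_⊎-⇔_)
open import Function using (_∘_)
open import Function.Bundles using (_⇔_; mk⇔; Equivalence)
open import Function.Construct.Identity using (⇔-id)
open import Function.Related.TypeIsomorphisms using (→-cong-⇔; ¬-cong-⇔)
open import Axiom.ExcludedMiddle using (ExcludedMiddle)
open import Relation.Nullary using (¬_; yes; no)
open import Relation.Binary.PropositionalEquality
  using (_≡_; _≗_; refl; sym; trans; cong; module ≡-Reasoning)
open import Relation.Binary.Structures using (IsEquivalence)

open Equivalence using (to; from)

translateTerm : ∀ {n} → CTerm n → STerm n
translateTerm (var i) = var i
translateTerm (`f t)  = `S (translateTerm t)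
translateTerm (`g t)  = `S (translateTerm t)

reachesFin : ∀ {n} → ℕ → STerm n → SFormula n
reachesFin k u = iter `S k u `≐ `cfin

translate : ∀ {n} → EqFormula n → SFormula n
translate (`E t s)            = translateTerm t `≐ translateTerm s
translate (`CInit+ k t)       = translateTerm t `≐ iter `S k `cinit
translate (`CFin- zero t)     = reachesFin 0 (translateTerm t)
translate (`CFin- (suc k) t)  =
  reachesFin (suc k) (translateTerm t) `∧ `¬ (reachesFin k (translateTerm t))
translate `⊤                  = `⊤
translate `⊥                  = `⊥
translate (`¬ φ)              = `¬ (translate φ)
translate (φ `∧ ψ)            = translate φ `∧ translate ψ
translate (φ `∨ ψ)            = translate φ `∨ translate ψ
translate (φ `⇒ ψ)            = translate φ `⇒ translate ψ
translate (`∀ φ)              = `∀ (translate φ)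
translate (`∃ φ)              = `∃ (translate φ)

evalS-iter : (N : StarStr) {n : ℕ} (ρ : Fin n → StarStr.Q N) (k : ℕ) (t : STerm n) →
             evalS N ρ (iter `S k t) ≡ iter (StarStr.S N) k (evalS N ρ t)
evalS-iter N ρ zero    t = refl
evalS-iter N ρ (suc k) t = cong (StarStr.S N) (evalS-iter N ρ k t)

extend-≗ : ∀ {A B : Set} {n} (h : A → B) {a : A} {b : B} {α : Fin n → A} {β : Fin n → B} →
           h a ≡ b → h ∘ α ≗ β → h ∘ extend a α ≗ extend b β
extend-≗ h ha≡b hα≗β zero    = ha≡b
extend-≗ h ha≡b hα≗β (suc i) = hα≗β i

module _ (Sₘ : Str) (T : IsModelT Sₘ)
         (N : StarStr) (π : Str.M Sₘ → StarStr.Q N) (st : IsStarOf Sₘ N π) where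
  open Str Sₘ
  open StarStr N
  open IsModelT T
  open IsStarOf st
  open IsEquivalence equiv using () renaming (refl to E-refl)

  π-f : ∀ x → π (f x) ≡ S (π x)
  π-f x = sym (S-π x)

  π-g : ∀ x → π (g x) ≡ S (π x)
  π-g x = trans (sym (from (kernel (f x) (g x)) (compat E-refl))) (π-f x)

  π-iter : ∀ k x → π (iter f k x) ≡ iter S k (π x)
  π-iter zero    x = refl
  π-iter (suc k) x = trans (π-f (iter f k x)) (cong S (π-iter k x))

  class⇔ : (P : M → Set) → IsClass Sₘ P → (c : Q) → (∀ a → P a → c ≡ π a) →
           ∀ x → P x ⇔ (π x ≡ c)
  class⇔ P (c₀ , P⇔Ec₀) c c≡π x = mk⇔
    (λ Px → sym (c≡π x Px))
    (λ πx≡c → from (P⇔Ec₀ x)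
      (to (kernel x c₀) (trans πx≡c (c≡π c₀ (from (P⇔Ec₀ c₀) E-refl)))))

  fixed⇔ : ∀ x → FixF Sₘ x ⇔ (π x ≡ cfin)
  fixed⇔ = class⇔ (FixF Sₘ) fin-cls cfin cfin-π

  initial⇔ : ∀ x → NoPreF Sₘ x ⇔ (π x ≡ cinit)
  initial⇔ = class⇔ (NoPreF Sₘ) init-cls cinit cinit-π

  iterFixed⇔ : ∀ k x → FixF Sₘ (iter f k x) ⇔ (iter S k (π x) ≡ cfin)
  iterFixed⇔ k x = mk⇔
    (λ fixed → trans (sym (π-iter k x)) (to (fixed⇔ (iter f k x)) fixed))
    (λ reaches → from (fixed⇔ (iter f k x)) (trans (π-iter k x) reaches))

  evalC-π : ∀ {n} {a : Fin n → M} {ρ : Fin n → Q} → π ∘ a ≗ ρ →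
            ∀ t → π (evalC Sₘ a t) ≡ evalS N ρ (translateTerm t)
  evalC-π πa≗ρ (var i) = πa≗ρ i
  evalC-π πa≗ρ (`f t)  = trans (π-f _) (cong S (evalC-π πa≗ρ t))
  evalC-π πa≗ρ (`g t)  = trans (π-g _) (cong S (evalC-π πa≗ρ t))

  reachesFin-sound : ∀ {n} {a : Fin n → M} {ρ : Fin n → Q} → π ∘ a ≗ ρ → ∀ k t →
                     FixF Sₘ (iter f k (evalC Sₘ a t)) ⇔ satS N (reachesFin k (translateTerm t)) ρ
  reachesFin-sound {ρ = ρ} πa≗ρ k t = mk⇔
    (λ fixed → trans (sym πS^k) (to (iterFixed⇔ k _) fixed))
    (λ reaches → from (iterFixed⇔ k _) (trans πS^k reaches))
    where
    πS^k : iter S k (π (evalC Sₘ _ t)) ≡ evalS N ρ (iter `S k (translateTerm t))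
    πS^k = trans (cong (iter S k) (evalC-π πa≗ρ t)) (sym (evalS-iter N ρ k (translateTerm t)))

  module _ (em : ExcludedMiddle 0ℓ) where

    nonInitial⇒movingPreimage : ∀ x → ¬ NoPreF Sₘ x → ∃ λ z → ¬ FixF Sₘ z × f z ≡ x
    nonInitial⇒movingPreimage x x-hasPre with em {FixF Sₘ x}
    ... | yes x-fixed with ax-f-fin x x E-refl x-hasPre x-fixed
    ...   | z , (z-moving , fz≡x , _) , _ = z , z-moving , fz≡x
    nonInitial⇒movingPreimage x x-hasPre | no x-moving with ax-f x x E-refl x-hasPre x-moving
    ...   | z , (fz≡x , _) , _ = z , z-moving , fz≡x
      where
      -- a fixed z would force x = f z = z, so f x = x
      z-moving : ¬ FixF Sₘ z
      z-moving fz≡z = x-moving (trans (cong f (trans (sym fz≡x) fz≡z)) fz≡x)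

    preimageInClass : ∀ x w → π x ≡ S (π w) → ∃ λ z → f z ≡ x × π z ≡ π w
    preimageInClass x w πx≡Sπw with em {FixF Sₘ w}
    ... | yes w-fixed = x , from (fixed⇔ x) πx≡cfin , trans πx≡cfin (sym (to (fixed⇔ w) w-fixed))
      where
      πx≡cfin : π x ≡ cfin
      πx≡cfin = trans πx≡Sπw (trans (S-π w) (to (fixed⇔ (f w)) (cong f w-fixed)))
    ... | no w-moving with nonInitial⇒movingPreimage x x-hasPre
      where
      πx≡πfw : π x ≡ π (f w)
      πx≡πfw = trans πx≡Sπw (S-π w)
      x-hasPre : ¬ NoPreF Sₘ x
      x-hasPre x-initial =
        from (initial⇔ (f w)) (trans (sym πx≡πfw) (to (initial⇔ x) x-initial)) (w , refl)
    ...   | z , z-moving , fz≡x =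
      z , fz≡x , from (kernel z w) (ax-e z-moving w-moving (to (kernel (f z) (f w)) πfz≡πfw))
      where
      πfz≡πfw : π (f z) ≡ π (f w)
      πfz≡πfw = trans (cong π fz≡x) (trans πx≡Sπw (S-π w))

    CInit+⇔ : ∀ k x → CInit+ Sₘ k x ⇔ (π x ≡ iter S k cinit)
    CInit+⇔ k x = mk⇔ reached reaches
      where
      reached : CInit+ Sₘ k x → π x ≡ iter S k cinit
      reached (z , z-initial , f^kz≡x) = begin
        π x                ≡⟨ cong π (sym f^kz≡x) ⟩
        π (iter f k z)     ≡⟨ π-iter k z ⟩
        iter S k (π z)     ≡⟨ cong (iter S k) (to (initial⇔ z) z-initial) ⟩
        iter S k cinit     ∎
        where open ≡-Reasoning

      reaches : π x ≡ iter S k cinit → CInit+ Sₘ k x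
      reaches = go k x
        where
        go : ∀ k x → π x ≡ iter S k cinit → CInit+ Sₘ k x
        go zero    x πx≡cinit = x , from (initial⇔ x) πx≡cinit , refl
        go (suc k) x πx≡S^k+1 with surj (iter S k cinit)
        ... | w , πw≡S^k with preimageInClass x w (trans πx≡S^k+1 (cong S (sym πw≡S^k)))
        ...   | z , fz≡x , πz≡πw with go k z (trans πz≡πw πw≡S^k)
        ...     | z₀ , z₀-initial , f^kz₀≡z = z₀ , z₀-initial , trans (cong f f^kz₀≡z) fz≡x

    translate-sound : ∀ {n} (φ : EqFormula n) (a : Fin n → M) (ρ : Fin n → Q) →
                      π ∘ a ≗ ρ → satC Sₘ φ a ⇔ satS N (translate φ) ρ
    translate-sound (`E t s) a ρ πa≗ρ = mk⇔
      (λ Ets → trans (sym (π⟦ t ⟧)) (trans (from (kernel _ _) Ets) π⟦ s ⟧))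
      (λ eq → to (kernel _ _) (trans π⟦ t ⟧ (trans eq (sym π⟦ s ⟧))))
      where
      π⟦_⟧ : ∀ t → π (evalC Sₘ a t) ≡ evalS N ρ (translateTerm t)
      π⟦_⟧ = evalC-π πa≗ρ
    translate-sound (`CInit+ k t) a ρ πa≗ρ = mk⇔
      (λ c → trans (sym (evalC-π πa≗ρ t)) (trans (to (CInit+⇔ k _) c) (sym S^kcinit)))
      (λ eq → from (CInit+⇔ k _) (trans (evalC-π πa≗ρ t) (trans eq S^kcinit)))
      where
      S^kcinit : evalS N ρ (iter `S k `cinit) ≡ iter S k cinit
      S^kcinit = evalS-iter N ρ k `cinit
    translate-sound (`CFin- zero t)    a ρ πa≗ρ = reachesFin-sound πa≗ρ 0 t
    translate-sound (`CFin- (suc k) t) a ρ πa≗ρ =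
      reachesFin-sound πa≗ρ (suc k) t ×-⇔ ¬-cong-⇔ (reachesFin-sound πa≗ρ k t)
    translate-sound `⊤       _ _ _ = ⇔-id _
    translate-sound `⊥       _ _ _ = ⇔-id _
    translate-sound (`¬ φ)   a ρ πa≗ρ = ¬-cong-⇔ (translate-sound φ a ρ πa≗ρ)
    translate-sound (φ `∧ ψ) a ρ πa≗ρ = translate-sound φ a ρ πa≗ρ ×-⇔ translate-sound ψ a ρ πa≗ρ
    translate-sound (φ `∨ ψ) a ρ πa≗ρ = translate-sound φ a ρ πa≗ρ ⊎-⇔ translate-sound ψ a ρ πa≗ρ
    translate-sound (φ `⇒ ψ) a ρ πa≗ρ =
      →-cong-⇔ (translate-sound φ a ρ πa≗ρ) (translate-sound ψ a ρ πa≗ρ)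
    translate-sound (`∀ φ) a ρ πa≗ρ = mk⇔
      (λ ∀m q → let (m , πm≡q) = surj q in to (sound-at m q πm≡q) (∀m m))
      (λ ∀q m → from (sound-at m (π m) refl) (∀q (π m)))
      where
      sound-at : ∀ m q → π m ≡ q → satC Sₘ φ (extend m a) ⇔ satS N (translate φ) (extend q ρ)
      sound-at m q πm≡q = translate-sound φ (extend m a) (extend q ρ) (extend-≗ π πm≡q πa≗ρ)
    translate-sound (`∃ φ) a ρ πa≗ρ = mk⇔
      (λ { (m , φm) → π m , to (sound-at m (π m) refl) φm })
      (λ { (q , φq) → let (m , πm≡q) = surj q in m , from (sound-at m q πm≡q) φq })
      where
      sound-at : ∀ m q → π m ≡ q → satC Sₘ φ (extend m a) ⇔ satS N (translate φ) (extend q ρ)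
      sound-at m q πm≡q = translate-sound φ (extend m a) (extend q ρ) (extend-≗ π πm≡q πa≗ρ)

lemma4p13 : ExcludedMiddle 0ℓ →
    (Sₘ : Str) → IsModelT Sₘ →
    (N : StarStr) (π : Str.M Sₘ → StarStr.Q N) → IsStarOf Sₘ N π →
    ∀ {n : ℕ} (φ : EqFormula n) → Σ (SFormula n) λ φ⋆ →
    (a : Fin n → Str.M Sₘ) → satC Sₘ φ a ⇔ satS N φ⋆ (π ∘ a)
lemma4p13 em Sₘ T N π st φ =
  translate φ , λ a → translate-sound Sₘ T N π st em φ a (π ∘ a) (λ _ → refl)
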